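{- For the posets $N_k$ defined below, $\mathrm{ITLB}(N_k)=\Theta(k)$ as $k\to\infty$.
   Context: For a poset $R$, $\Delta(R)$ is its set of linear extensions (total orders on its ground set extending its order) and $\mathrm{ITLB}(R)=\ln|\Delta(R)|$. For $k\in\mathbb{N}$, $N_k$ is the poset on $4k$ elements formed by four chains $A=(a_i)_{i\in[k]}$, $B=(b_i)_{i\in[k]}$, $C=(c_i)_{i\in[k]}$, $D=(d_i)_{i\in[k]}$ (each totally ordered, $a_1<\dots<a_k$ etc.), obtained from the $N$ poset on $\{a,b,c,d\}$ (with relations $a\le b$, $c\le b$, $c\le d$ and all other pairs incomparable) by replacing each of $a,b,c,d$ by the corresponding chain; i.e. every element of $A$ is below every element of $B$, every element of $C$ is below every element of $B$ and of $D$, and no other relations between different chains hold. -}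

module Defs where

open import Data.Nat using (ℕ; _*_; _≤_)
open import Data.Fin using (Fin; toℕ)
open import Data.Product using (_×_; _,_)
open import Data.Sum using (_⊎_)
open import Data.Vec using (Vec; lookup)
open import Relation.Binary.PropositionalEquality using (_≡_)

data Chain : Set where
  A B C D : Chain

-- Ground set of N_k: (X , i) is the i-th element of chain X (i ∈ [k], 0-indexed).
Elem : ℕ → Set
Elem k = Chain × Fin k

data _≤N_ {k : ℕ} : Elem k → Elem k → Set where
  same : ∀ {X} {i j : Fin k} → toℕ i ≤ toℕ j → (X , i) ≤N (X , j)
  a≤b  : ∀ {i j : Fin k} → (A , i) ≤N (B , j)
  c≤b  : ∀ {i j : Fin k} → (C , i) ≤N (B , j)
  c≤d  : ∀ {i j : Fin k} → (C , i) ≤N (D , j)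

-- A linear extension of N_k, given as the listing of the 4k elements of the
-- ground set from smallest to largest in the total order: the listing is
-- injective (hence a bijection, |Elem k| = 4k) and respects the order of N_k.
-- Proof fields are irrelevant, so two linear extensions are equal iff their
-- listings (i.e. the total orders) coincide.
record LinExt (k : ℕ) : Set where
  constructor linExt
  field
    listing   : Vec (Elem k) (4 * k)
    .distinct : ∀ p q → lookup listing p ≡ lookup listing q → p ≡ q
    .respects : ∀ p q → lookup listing p ≤N lookup listing q → toℕ p ≤ toℕ q

module Submission where

-- In a linear extension each chain is listed in increasing order, so the
-- element at a position is determined by the chain it belongs to (two such listings with
-- the same chain labels agree, by strong induction on the position).  Hence the word of
-- chain labels, one of 4^(4k) = 256^k words, determines the extension.
--
-- Any injective order-preserving ranking of N_k into positions 0 … 4k-1 is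
-- the position map of a linear extension, and can be read back from it.  Listing C first,
-- then the pairs {a_i, d_i} for i = 0 … k-1 each in an order chosen by a bit, then B, gives
-- such rankings for every bit vector in {0,1}^k, hence 2^k distinct extensions.

open import Defs
open import Data.Bool using (Bool; true; false; not; T)
open import Data.Bool.Properties using (not-¬; T-irrelevant)
open import Data.Empty using (⊥; ⊥-elim)
open import Data.Fin using (Fin; zero; suc; toℕ; punchOut; combine; cast)
open import Data.Fin.Properties
  using (any?; all?; injective⇒≤; <⇒notInjective; punchOut-injective; toℕ-injective; toℕ<n;
         *↔×; +↔⊎; 0↔⊥; 1↔⊤; 2↔Bool; combine-monoˡ-<; combine-injective; toℕ-↑ˡ; toℕ-↑ʳ;
         toℕ-cast)
  renaming (_≟_ to _≟ᶠ_)
open import Data.Nat using (ℕ; zero; suc; _+_; _*_; _^_; _≤_; _<_; _≤?_)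
open import Data.Nat.Properties
  using (≤-refl; <⇒≤; n<1+n; m≤m+n; <-≤-trans; +-monoʳ-<; +-monoʳ-≤; m<1+n⇒m<n∨m≡n;
         m≤n⇒m<n∨m≡n; <-cmp; <-irrefl; ^-*-assoc; *-identityˡ; ^-identityʳ)
open import Data.Nat.Tactic.RingSolver using (solve-∀)
open import Data.Product using (Σ; ∃; _×_; _,_; proj₁; proj₂)
open import Data.Product.Properties using (≡-dec)
open import Data.Product.Function.NonDependent.Propositional using (_×-cong_)
import Data.Product.Function.Dependent.Propositional as Σ
open import Data.Sum using (_⊎_; inj₁; inj₂)
open import Data.Sum.Properties using (inj₁-injective; inj₂-injective)
open import Data.Sum.Function.Propositional using (_⊎-cong_)
open import Data.Vec using (Vec; []; _∷_; lookup; map; tabulate)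
open import Data.Vec.Properties using (lookup-map; lookup∘tabulate; tabulate∘lookup; tabulate-cong)
open import Function using (_∘_; _∋_)
open import Function.Bundles using (_↔_; Inverse; Injection; mk↔ₛ′)
open import Function.Definitions using (Injective; StrictlySurjective)
open import Function.Properties.Inverse using (↔-refl; ↔-sym; ↔-trans; ↔⇒↣)
open import Function.Related.Propositional using (bijection)
open import Relation.Binary.Definitions using (DecidableEquality; tri<; tri≈; tri>)
open import Relation.Binary.PropositionalEquality
open import Relation.Nullary using (Dec; yes; no)
open import Relation.Nullary.Decidable
  using (map′; _×-dec_; _→-dec_; recompute; isYes; toWitness; fromWitness; via-injection)

open Inverse using (to; from)

Finite : Set → Set
Finite X = Σ ℕ λ n → X ↔ Fin n

↔-injective : ∀ {X Y : Set} (f : X ↔ Y) → Injective _≡_ _≡_ (to f)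
↔-injective f = Injection.injective (↔⇒↣ f)

lookup-ext : ∀ {X : Set} {n} {u v : Vec X n} → (∀ i → lookup u i ≡ lookup v i) → u ≡ v
lookup-ext {u = u} {v} same-entries =
  trans (sym (tabulate∘lookup u)) (trans (tabulate-cong same-entries) (tabulate∘lookup v))

onFin-injective : ∀ {X Y : Set} {m n} (f : X ↔ Fin m) (g : Y ↔ Fin n) {h : X → Y} →
                  Injective _≡_ _≡_ h → Injective _≡_ _≡_ (to g ∘ h ∘ from f)
onFin-injective f g h-inj e = ↔-injective (↔-sym f) (h-inj (↔-injective g e))

injection⇒≤ : ∀ {X Y : Set} {m n} → X ↔ Fin m → Y ↔ Fin n →
              (h : X → Y) → Injective _≡_ _≡_ h → m ≤ n
injection⇒≤ f g h h-inj = injective⇒≤ {f = to g ∘ h ∘ from f} (onFin-injective f g h-inj)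

-- Pigeonhole principle: an injective self-map of Fin n is onto, for otherwise it would
-- squeeze Fin n injectively into the n - 1 values it hits.
Fin-injective⇒surjective : ∀ {n} (h : Fin n → Fin n) → Injective _≡_ _≡_ h →
                           StrictlySurjective _≡_ h
Fin-injective⇒surjective {suc n} h h-inj y with any? (λ x → h x ≟ᶠ y)
... | yes hit = hit
... | no miss = ⊥-elim (<⇒notInjective {f = squeeze} (n<1+n n) squeeze-injective)
  where
  y≢h : ∀ x → y ≢ h x
  y≢h x y≡hx = miss (x , sym y≡hx)
  squeeze : Fin (suc n) → Fin n
  squeeze x = punchOut (y≢h x)
  squeeze-injective : Injective _≡_ _≡_ squeeze
  squeeze-injective {x} {x′} e = h-inj (punchOut-injective (y≢h x) (y≢h x′) e)

injective⇒surjective : ∀ {X Y : Set} {n} → X ↔ Fin n → Y ↔ Fin n →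
                       (h : X → Y) → Injective _≡_ _≡_ h → StrictlySurjective _≡_ h
injective⇒surjective f g h h-inj y
  with Fin-injective⇒surjective (to g ∘ h ∘ from f) (onFin-injective f g h-inj) (to g y)
... | p , hit = from f p , ↔-injective g hit

Σ-Fin-suc : ∀ {m} (P : Fin (suc m) → Set) → Σ (Fin (suc m)) P ↔ (P zero ⊎ Σ (Fin m) (P ∘ suc))
Σ-Fin-suc P = mk↔ₛ′ split unsplit
  (λ { (inj₁ _) → refl ; (inj₂ _) → refl })
  (λ { (zero , _) → refl ; (suc _ , _) → refl })
  where
  split : Σ _ P → P zero ⊎ Σ _ (P ∘ suc)
  split (zero  , x) = inj₁ x
  split (suc i , x) = inj₂ (i , x)
  unsplit : P zero ⊎ Σ _ (P ∘ suc) → Σ _ P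
  unsplit (inj₁ x)       = zero , x
  unsplit (inj₂ (i , x)) = suc i , x

⊎-finite : ∀ {X Y : Set} → Finite X → Finite Y → Finite (X ⊎ Y)
⊎-finite (m , f) (n , g) = m + n , ↔-trans (f ⊎-cong g) (↔-sym +↔⊎)

T-finite : ∀ b → Finite (T b)
T-finite true  = 1 , ↔-sym 1↔⊤
T-finite false = 0 , ↔-sym 0↔⊥

Fin-subset-finite : ∀ {m} (b : Fin m → Bool) → Finite (Σ (Fin m) (T ∘ b))
Fin-subset-finite {zero}  b = 0 , mk↔ₛ′ (λ { (() , _) }) (λ ()) (λ ()) (λ { (() , _) })
Fin-subset-finite {suc m} b with ⊎-finite (T-finite (b zero)) (Fin-subset-finite (b ∘ suc))
... | n , f = n , ↔-trans (Σ-Fin-suc (T ∘ b)) f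

subset-finite : ∀ {X : Set} → Finite X → (b : X → Bool) → Finite (Σ X (T ∘ b))
subset-finite (m , f) b with Fin-subset-finite (b ∘ from f)
... | n , g = n , ↔-trans (↔-sym (Σ.cong {k = bijection} (↔-sym f) ↔-refl)) g

Vec↔Fin : ∀ {X : Set} {a} → X ↔ Fin a → ∀ n → Vec X n ↔ Fin (a ^ n)
Vec↔Fin f zero = mk↔ₛ′ (λ _ → zero) (λ _ → []) (λ { zero → refl }) (λ { [] → refl })
Vec↔Fin {X} {a} f (suc n) =
  ↔-trans uncons (↔-trans (f ×-cong Vec↔Fin f n) (↔-sym (*↔× {a} {a ^ n})))
  where
  uncons : Vec X (suc n) ↔ (X × Vec X n)
  uncons = mk↔ₛ′ (λ { (x ∷ xs) → x , xs }) (λ (x , xs) → x ∷ xs)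
    (λ _ → refl) (λ { (_ ∷ _) → refl })

Chain↔Fin4 : Chain ↔ Fin 4
Chain↔Fin4 = mk↔ₛ′ code decode
  (λ { zero → refl ; (suc zero) → refl ; (suc (suc zero)) → refl ; (suc (suc (suc zero))) → refl })
  (λ { A → refl ; B → refl ; C → refl ; D → refl })
  where
  code : Chain → Fin 4
  code A = zero
  code B = suc zero
  code C = suc (suc zero)
  code D = suc (suc (suc zero))
  decode : Fin 4 → Chain
  decode zero                   = A
  decode (suc zero)             = B
  decode (suc (suc zero))       = C
  decode (suc (suc (suc zero))) = D

Elem↔Fin : ∀ k → Elem k ↔ Fin (4 * k)
Elem↔Fin k = ↔-trans (Chain↔Fin4 ×-cong ↔-refl) (↔-sym (*↔× {4} {k}))

_≟ᶜ_ : DecidableEquality Chain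
_≟ᶜ_ = via-injection (↔⇒↣ Chain↔Fin4) _≟ᶠ_

_≟ᵉ_ : ∀ {k} → DecidableEquality (Elem k)
_≟ᵉ_ = ≡-dec _≟ᶜ_ _≟ᶠ_

same? : ∀ {k X} (i j : Fin k) → Dec ((X , i) ≤N (X , j))
same? i j = map′ same (λ { (same i≤j) → i≤j }) (toℕ i ≤? toℕ j)

_≤N?_ : ∀ {k} (x y : Elem k) → Dec (x ≤N y)
(A , i) ≤N? (A , j) = same? i j
(B , i) ≤N? (B , j) = same? i j
(C , i) ≤N? (C , j) = same? i j
(D , i) ≤N? (D , j) = same? i j
(A , _) ≤N? (B , _) = yes a≤b
(C , _) ≤N? (B , _) = yes c≤b
(C , _) ≤N? (D , _) = yes c≤d
(A , _) ≤N? (C , _) = no λ ()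
(A , _) ≤N? (D , _) = no λ ()
(B , _) ≤N? (A , _) = no λ ()
(B , _) ≤N? (C , _) = no λ ()
(B , _) ≤N? (D , _) = no λ ()
(C , _) ≤N? (A , _) = no λ ()
(D , _) ≤N? (A , _) = no λ ()
(D , _) ≤N? (B , _) = no λ ()
(D , _) ≤N? (C , _) = no λ ()

Distinct Respects IsLinExt : ∀ {k} → Vec (Elem k) (4 * k) → Set
Distinct l = ∀ p q → lookup l p ≡ lookup l q → p ≡ q
Respects l = ∀ p q → lookup l p ≤N lookup l q → toℕ p ≤ toℕ q
IsLinExt l = Distinct l × Respects l

isLinExt? : ∀ {k} (l : Vec (Elem k) (4 * k)) → Dec (IsLinExt l)
isLinExt? l =
  all? (λ p → all? (λ q → (lookup l p ≟ᵉ lookup l q) →-dec (p ≟ᶠ q))) ×-dec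
  all? (λ p → all? (λ q → (lookup l p ≤N? lookup l q) →-dec (toℕ p ≤? toℕ q)))

-- LinExt keeps its conditions as irrelevant fields; being decidable they can be recovered.
isLinExt : ∀ {k} (e : LinExt k) → IsLinExt (LinExt.listing e)
isLinExt (linExt l d r) = recompute (isLinExt? l) (d , r)

listing-injective : ∀ {k} {e e′ : LinExt k} → LinExt.listing e ≡ LinExt.listing e′ → e ≡ e′
listing-injective refl = refl

LinExt↔valid : ∀ k → LinExt k ↔ Σ (Vec (Elem k) (4 * k)) (T ∘ isYes ∘ isLinExt?)
LinExt↔valid k = mk↔ₛ′
  (λ e → LinExt.listing e , fromWitness (isLinExt e))
  (λ (l , ok) → linExt l (proj₁ (toWitness ok)) (proj₂ (toWitness ok)))
  (λ (l , ok) → cong (l ,_) (T-irrelevant _ _))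
  (λ _ → refl)

LinExt-finite : ∀ k → Finite (LinExt k)
LinExt-finite k =
  let (n , f) = subset-finite listings (isYes ∘ isLinExt?) in n , ↔-trans (LinExt↔valid k) f
  where
  listings : Finite (Vec (Elem k) (4 * k))
  listings = (4 * k) ^ (4 * k) , Vec↔Fin (Elem↔Fin k) (4 * k)

-- Upper bound: the chain labels determine a linear extension.

module _ {L : Set} {k N : ℕ} where

  record IsChainListing (f : Fin N → L × Fin k) : Set where
    field
      injective  : Injective _≡_ _≡_ f
      surjective : StrictlySurjective _≡_ f
      monotone   : ∀ {p q X i j} → f p ≡ (X , i) → f q ≡ (X , j) →
                   toℕ i ≤ toℕ j → toℕ p ≤ toℕ q
  open IsChainListing

  AgreeBelow : (f g : Fin N → L × Fin k) → ℕ → Set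
  AgreeBelow f g n = ∀ r → toℕ r < n → f r ≡ g r

  -- If f and g agree before position p where f lists (X , i), then g cannot list a later
  -- element (X , j) of the same chain at p: g lists (X , i) somewhere, not after p since g
  -- is monotone, and not before p since f already lists it at p.
  no-overtaking : ∀ {f g} → Injective _≡_ _≡_ f → IsChainListing g →
                  ∀ {p X i j} → AgreeBelow f g (toℕ p) → f p ≡ (X , i) → g p ≡ (X , j) →
                  toℕ i < toℕ j → ⊥
  no-overtaking {f} {g} f-inj G {p} {X} {i} {j} below fp gp i<j with surjective G (X , i)
  ... | r , gr with m≤n⇒m<n∨m≡n (monotone G gr gp (<⇒≤ i<j))
  ...   | inj₁ r<p = <-irrefl (cong toℕ (f-inj (trans (below r r<p) (trans gr (sym fp))))) r<p
  ...   | inj₂ r≡p = <-irrefl (cong (toℕ ∘ proj₂) same-element) i<j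
    where
    same-element : (X , i) ≡ (X , j)
    same-element = trans (sym gr) (trans (cong g (toℕ-injective r≡p)) gp)

  -- Two chain listings with the same chain label at every position are equal, by strong
  -- induction on the position (no-overtaking in both directions).
  labels-determine : ∀ {f g} → IsChainListing f → IsChainListing g →
                     (∀ p → proj₁ (f p) ≡ proj₁ (g p)) → ∀ p → f p ≡ g p
  labels-determine {f} {g} F G same-label p = agree-below (suc (toℕ p)) p ≤-refl
    where
    agree-at : ∀ p → AgreeBelow f g (toℕ p) → f p ≡ g p
    agree-at p below = compare (f p) (g p) refl refl
      where
      compare : ∀ x y → f p ≡ x → g p ≡ y → f p ≡ g p
      compare (X , i) (Y , j) fp gp
        with trans (cong proj₁ (sym fp)) (trans (same-label p) (cong proj₁ gp))
      ... | refl with <-cmp (toℕ i) (toℕ j)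
      ...   | tri< i<j _ _ = ⊥-elim (no-overtaking (injective F) G below fp gp i<j)
      ...   | tri> _ _ j<i =
              ⊥-elim (no-overtaking (injective G) F (λ r r<p → sym (below r r<p)) gp fp j<i)
      ...   | tri≈ _ i≡j _ = trans fp (trans (cong (X ,_) (toℕ-injective i≡j)) (sym gp))

    agree-below : ∀ n → AgreeBelow f g n
    agree-below zero    _ ()
    agree-below (suc n) r r<1+n with m<1+n⇒m<n∨m≡n r<1+n
    ... | inj₁ r<n  = agree-below n r r<n
    ... | inj₂ refl = agree-at r (agree-below n)

listing-isChainListing : ∀ {k} (e : LinExt k) → IsChainListing (lookup (LinExt.listing e))
listing-isChainListing {k} e = record
  { injective  = distinct _ _
  ; surjective = injective⇒surjective ↔-refl (Elem↔Fin k) _ (distinct _ _)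
  ; monotone   = λ fp fq i≤j → respects _ _ (subst₂ _≤N_ (sym fp) (sym fq) (same i≤j))
  }
  where
  distinct : Distinct (LinExt.listing e)
  distinct = proj₁ (isLinExt e)
  respects : Respects (LinExt.listing e)
  respects = proj₂ (isLinExt e)

labels : ∀ {k} → LinExt k → Vec Chain (4 * k)
labels e = map proj₁ (LinExt.listing e)

labels-injective : ∀ {k} → Injective _≡_ _≡_ (labels {k})
labels-injective {k} {e} {e′} same-word =
  listing-injective (lookup-ext (labels-determine (listing-isChainListing e)
                                                  (listing-isChainListing e′) same-label))
  where
  same-label : ∀ p → proj₁ (lookup (LinExt.listing e) p) ≡ proj₁ (lookup (LinExt.listing e′) p)
  same-label p = trans (sym (lookup-map p proj₁ (LinExt.listing e)))
                       (trans (cong (λ w → lookup w p) same-word)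
                              (lookup-map p proj₁ (LinExt.listing e′)))

-- There are at most 4^(4k) = 256^k label words, hence at most 256^k linear extensions.
at-most-256^k : ∀ {k n} → LinExt k ↔ Fin n → n ≤ 256 ^ k
at-most-256^k {k} {n} f =
  subst (n ≤_) (sym (^-*-assoc 4 4 k))
        (injection⇒≤ f (Vec↔Fin Chain↔Fin4 (4 * k)) labels labels-injective)

-- Lower bound: linear extensions from rankings.

record IsRanking {k} (rank : Elem k → Fin (4 * k)) : Set where
  field
    injective : Injective _≡_ _≡_ rank
    monotone  : ∀ {x y} → x ≤N y → toℕ (rank x) ≤ toℕ (rank y)

-- Every ranking is the position map of a linear extension: list at position p the unique
-- element of rank p (rank is onto by the pigeonhole principle).
module FromRanking {k} {rank : Elem k → Fin (4 * k)} (R : IsRanking rank) where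
  open IsRanking R

  onto : StrictlySurjective _≡_ rank
  onto = injective⇒surjective (Elem↔Fin k) ↔-refl rank injective

  element : Fin (4 * k) → Elem k
  element p = proj₁ (onto p)

  rank-element : ∀ p → rank (element p) ≡ p
  rank-element p = proj₂ (onto p)

  linExtOf : LinExt k
  linExtOf = linExt (tabulate element) distinct respects
    where
    at : ∀ p → lookup (tabulate element) p ≡ element p
    at = lookup∘tabulate element
    distinct : Distinct (tabulate element)
    distinct p q e = trans (sym (rank-element p))
                           (trans (cong rank (trans (sym (at p)) (trans e (at q)))) (rank-element q))
    respects : Respects (tabulate element)
    respects p q x≤y = subst₂ _≤_ (cong toℕ (rank-element p)) (cong toℕ (rank-element q))
                                  (monotone (subst₂ _≤N_ (at p) (at q) x≤y))

  rank-listing : ∀ p → rank (lookup (LinExt.listing linExtOf) p) ≡ p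
  rank-listing p = trans (cong rank (lookup∘tabulate element p)) (rank-element p)

  listing-rank : ∀ x → lookup (LinExt.listing linExtOf) (rank x) ≡ x
  listing-rank x = injective (rank-listing (rank x))

ranking-determined : ∀ {k} {r r′ : Elem k → Fin (4 * k)} (R : IsRanking r) (R′ : IsRanking r′) →
                     FromRanking.linExtOf R ≡ FromRanking.linExtOf R′ → ∀ x → r x ≡ r′ x
ranking-determined {r = r} {r′} R R′ same-ext x = begin
  r x                                                          ≡⟨ FromRanking.rank-listing R′ (r x) ⟨
  r′ (lookup (LinExt.listing (FromRanking.linExtOf R′)) (r x)) ≡⟨ cong r′ listed-at-r ⟩
  r′ x                                                         ∎
  where
  open ≡-Reasoning
  listed-at-r : lookup (LinExt.listing (FromRanking.linExtOf R′)) (r x) ≡ x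
  listed-at-r = trans (cong (λ e → lookup (LinExt.listing e) (r x)) (sym same-ext))
                      (FromRanking.listing-rank R x)

-- The slots of the pair-choice extensions, in order: the C block, the k pairs of slots
-- (pair i occupies slots 2i and 2i+1 of the middle block), the B block.
Slot : ℕ → Set
Slot k = Fin k ⊎ (Fin (k * 2) ⊎ Fin k)

offset : ∀ {k} → Slot k → ℕ
offset     (inj₁ i)        = toℕ i
offset {k} (inj₂ (inj₁ c)) = k + toℕ c
offset {k} (inj₂ (inj₂ j)) = k + (k * 2 + toℕ j)

block-sizes : ∀ k → k + (k * 2 + k) ≡ 4 * k
block-sizes = solve-∀

Slot↔positions : ∀ k → Slot k ↔ Fin (k + (k * 2 + k))
Slot↔positions k = ↔-trans (↔-refl ⊎-cong ↔-sym +↔⊎) (↔-sym +↔⊎)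

place : ∀ {k} → Slot k → Fin (4 * k)
place {k} σ = cast (block-sizes k) (to (Slot↔positions k) σ)

place-injective : ∀ {k} → Injective _≡_ _≡_ (place {k})
place-injective {k} {σ} {τ} e = ↔-injective (Slot↔positions k)
  (toℕ-injective (trans (sym (toℕ-cast _ _)) (trans (cong toℕ e) (toℕ-cast _ _))))

toℕ-place : ∀ {k} (σ : Slot k) → toℕ (place σ) ≡ offset σ
toℕ-place {k} σ = trans (toℕ-cast _ _) (offset-of σ)
  where
  offset-of : ∀ σ → toℕ (to (Slot↔positions k) σ) ≡ offset σ
  offset-of (inj₁ i)        = toℕ-↑ˡ i _
  offset-of (inj₂ (inj₁ c)) = trans (toℕ-↑ʳ k _) (cong (k +_) (toℕ-↑ˡ c k))
  offset-of (inj₂ (inj₂ j)) = trans (toℕ-↑ʳ k _) (cong (k +_) (toℕ-↑ʳ (k * 2) j))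

C-block-first : ∀ {k} (i : Fin k) τ → offset (inj₁ i) < offset {k} (inj₂ τ)
C-block-first {k} i (inj₁ c) = <-≤-trans (toℕ<n i) (m≤m+n k (toℕ c))
C-block-first {k} i (inj₂ j) = <-≤-trans (toℕ<n i) (m≤m+n k (k * 2 + toℕ j))

pairs-before-B : ∀ {k} (c : Fin (k * 2)) (j : Fin k) →
                 offset {k} (inj₂ (inj₁ c)) < offset {k} (inj₂ (inj₂ j))
pairs-before-B {k} c j = +-monoʳ-< k (<-≤-trans (toℕ<n c) (m≤m+n (k * 2) (toℕ j)))

combine-monoˡ-≤ : ∀ {m n} (b : Fin m → Fin n) {i j : Fin m} →
                  toℕ i ≤ toℕ j → toℕ (combine i (b i)) ≤ toℕ (combine j (b j))
combine-monoˡ-≤ b {i} {j} i≤j with m≤n⇒m<n∨m≡n i≤j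
... | inj₁ i<j = <⇒≤ (combine-monoˡ-< (b i) (b j) i<j)
... | inj₂ i≡j rewrite toℕ-injective i≡j = ≤-refl

slotOfA : Bool → Fin 2
slotOfA true  = zero
slotOfA false = suc zero

slotOfA-injective : Injective _≡_ _≡_ slotOfA
slotOfA-injective {true}  {true}  _ = refl
slotOfA-injective {false} {false} _ = refl

pairSlot : ∀ {k} → Vec Bool k → Elem k → Slot k
pairSlot s (C , i) = inj₁ i
pairSlot s (A , i) = inj₂ (inj₁ (combine i (slotOfA (lookup s i))))
pairSlot s (D , i) = inj₂ (inj₁ (combine i (slotOfA (not (lookup s i)))))
pairSlot s (B , i) = inj₂ (inj₂ i)

middle-injective : ∀ {k} {i j : Fin k} {b b′ : Fin 2} →
                   (Slot k ∋ inj₂ (inj₁ (combine i b))) ≡ inj₂ (inj₁ (combine j b′)) →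
                   i ≡ j × b ≡ b′
middle-injective {i = i} {j} {b} {b′} =
  combine-injective i b j b′ ∘ inj₁-injective ∘ inj₂-injective

-- a_i and d_i take different slots of pair i; every other element has its own block or pair.
pairSlot-injective : ∀ {k} (s : Vec Bool k) → Injective _≡_ _≡_ (pairSlot s)
pairSlot-injective s {C , _} {C , _} refl = refl
pairSlot-injective s {B , _} {B , _} refl = refl
pairSlot-injective s {A , _} {A , _} e = cong (A ,_) (proj₁ (middle-injective e))
pairSlot-injective s {D , _} {D , _} e = cong (D ,_) (proj₁ (middle-injective e))
pairSlot-injective s {A , _} {D , _} e with middle-injective e
... | refl , same-slot = ⊥-elim (not-¬ refl (slotOfA-injective same-slot))
pairSlot-injective s {D , _} {A , _} e with middle-injective e
... | refl , same-slot = ⊥-elim (not-¬ refl (sym (slotOfA-injective same-slot)))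
pairSlot-injective s {C , _} {A , _} ()
pairSlot-injective s {C , _} {B , _} ()
pairSlot-injective s {C , _} {D , _} ()
pairSlot-injective s {A , _} {B , _} ()
pairSlot-injective s {A , _} {C , _} ()
pairSlot-injective s {B , _} {A , _} ()
pairSlot-injective s {B , _} {C , _} ()
pairSlot-injective s {B , _} {D , _} ()
pairSlot-injective s {D , _} {B , _} ()
pairSlot-injective s {D , _} {C , _} ()

pairSlot-monotone : ∀ {k} (s : Vec Bool k) {x y} → x ≤N y →
                    offset (pairSlot s x) ≤ offset (pairSlot s y)
pairSlot-monotone     s {C , _} (same i≤j) = i≤j
pairSlot-monotone {k} s {A , _} (same i≤j) = +-monoʳ-≤ k (combine-monoˡ-≤ (slotOfA ∘ lookup s) i≤j)
pairSlot-monotone {k} s {D , _} (same i≤j) =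
  +-monoʳ-≤ k (combine-monoˡ-≤ (slotOfA ∘ not ∘ lookup s) i≤j)
pairSlot-monotone {k} s {B , _} (same i≤j) = +-monoʳ-≤ k (+-monoʳ-≤ (k * 2) i≤j)
pairSlot-monotone s {A , i} {B , j} a≤b = <⇒≤ (pairs-before-B (combine i (slotOfA (lookup s i))) j)
pairSlot-monotone s {C , i} {B , j} c≤b = <⇒≤ (C-block-first i (inj₂ j))
pairSlot-monotone s {C , i} {D , j} c≤d =
  <⇒≤ (C-block-first i (inj₁ (combine j (slotOfA (not (lookup s j))))))

pairRanking : ∀ {k} (s : Vec Bool k) → IsRanking (place ∘ pairSlot s)
pairRanking s = record
  { injective = λ e → pairSlot-injective s (place-injective e)
  ; monotone  = λ {x} {y} x≤y →
      subst₂ _≤_ (sym (toℕ-place (pairSlot s x))) (sym (toℕ-place (pairSlot s y)))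
                 (pairSlot-monotone s x≤y)
  }

pairChoice : ∀ {k} → Vec Bool k → LinExt k
pairChoice s = FromRanking.linExtOf (pairRanking s)

-- Distinct bit vectors give distinct extensions: the slot of a_i recovers s_i.
pairChoice-injective : ∀ {k} → Injective _≡_ _≡_ (pairChoice {k})
pairChoice-injective {k} {s} {s′} same-ext = lookup-ext same-bit
  where
  same-bit : ∀ i → lookup s i ≡ lookup s′ i
  same-bit i = slotOfA-injective (proj₂ (middle-injective {k} (place-injective {k}
                 (ranking-determined (pairRanking s) (pairRanking s′) same-ext (A , i)))))

at-least-2^k : ∀ {k n} → LinExt k ↔ Fin n → 2 ^ k ≤ n
at-least-2^k {k} f = injection⇒≤ (Vec↔Fin (↔-sym 2↔Bool) k) f pairChoice pairChoice-injective

lemma15 : ∃ λ p → ∃ λ q → ∃ λ B → ∃ λ k₀ → 1 ≤ p × 1 ≤ q ×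
            ((k : ℕ) → k₀ ≤ k →
              Σ ℕ λ n → (LinExt k ↔ Fin n) × (2 ^ (p * k) ≤ n ^ q) × (n ≤ B ^ k))
lemma15 = 1 , 1 , 256 , 0 , ≤-refl , ≤-refl , λ k _ → bounds (LinExt-finite k)
  where
  bounds : ∀ {k} → Finite (LinExt k) →
           Σ ℕ λ n → (LinExt k ↔ Fin n) × (2 ^ (1 * k) ≤ n ^ 1) × (n ≤ 256 ^ k)
  bounds {k} (n , f) = n , f , lower , at-most-256^k f
    where
    lower : 2 ^ (1 * k) ≤ n ^ 1
    lower = subst₂ _≤_ (cong (2 ^_) (sym (*-identityˡ k))) (sym (^-identityʳ n)) (at-least-2^k f)
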